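{- Let $k\ge 2$. In every $k$-C-E ordering $\phi$ of $\Gamma_k$, the vertices $v_1$ and $v_2$ are the first and last vertices of $K$ in $\phi$ (in some order). Furthermore, there exists a $k$-C-E ordering $\phi$ of $\Gamma_k$ in which $v_1$ is the first element and $v_2$ is the last element of $\phi$.
   Context: All graphs are finite, simple and undirected. For an ordering $\phi$ of $V(G)$ write $a<_\phi b$ if $a$ precedes $b$; $w$ lies between $a$ and $b$ if $a<_\phi w<_\phi b$ or $b<_\phi w<_\phi a$. An ordering $\phi$ of $V(G)$ is a $k$-clique-extendible ordering ($k$-C-E ordering) of $G$ if whenever $X$ and $Y$ are cliques of size $k$ with $|X\cap Y|=k-1$, $X\setminus Y=\{a\}$, $Y\setminus X=\{b\}$, and all vertices of $X\cap Y$ lie between $a$ and $b$ in $\phi$, then $ab\in E(G)$. The graph $F_k$ has vertex set $K\cup I$, where $K=\{v_1,\dots,v_{2k-1}\}$ is a clique and $I=\{u_{i,j}: 1\le i<j\le 2k-1\}$ is an independent set, with $u_{i,j}$ adjacent to every vertex of $K$ except $v_i$ and $v_j$ and to nothing else. The graph $\Gamma_k$ is $F_k$ with the vertex $u_{1,2}$ deleted. -}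

module Defs where

open import Data.Nat using (ℕ; zero; suc; _+_; _*_; _∸_; _≤_; _<_; s≤s; z≤n; _<ᵇ_; _≡ᵇ_)
open import Data.Nat.Properties using (≤-trans; m≤n+m)
open import Data.Bool using (Bool; true; false; not; _∧_; T)
open import Data.Fin using (Fin; toℕ; fromℕ<)
open import Data.Product using (Σ; _×_; _,_; proj₁)
open import Data.Sum using (_⊎_)
open import Data.Unit using (tt)
open import Function.Bundles using (_⤖_; Bijection)
open import Function.Definitions using (Injective)
open import Relation.Binary.PropositionalEquality using (_≡_; _≢_; refl)
open import Relation.Nullary using (¬_)

record Graph : Set₁ where
  field
    V : Set
    E : V → V → Set
open Graph public

Ordering : Graph → Set
Ordering G = Σ ℕ (λ N → V G ⤖ Fin N)

_<[_]_ : {G : Graph} → V G → Ordering G → V G → Set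
a <[ (N , φ) ] b = toℕ (Bijection.to φ a) < toℕ (Bijection.to φ b)

Between : {G : Graph} → Ordering G → V G → V G → V G → Set
Between {G} φ a w b = (_<[_]_ {G} a φ w × _<[_]_ {G} w φ b)
                    ⊎ (_<[_]_ {G} b φ w × _<[_]_ {G} w φ a)

-- Two k-cliques X, Y with |X ∩ Y| = k-1,
-- X \ Y = {a}, Y \ X = {b} are exactly: a (k-1)-clique S (listed without
-- repetition), two distinct vertices a, b not in S, each adjacent to all of S.
IsKCE : (G : Graph) → ℕ → Ordering G → Set
IsKCE G k φ =
  (S : Fin (k ∸ 1) → V G) (a b : V G) →
  Injective _≡_ _≡_ S →
  (∀ i j → i ≢ j → E G (S i) (S j)) →
  (∀ i → a ≢ S i × E G a (S i)) →
  (∀ i → b ≢ S i × E G b (S i)) →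
  a ≢ b →
  (∀ i → Between {G} φ a (S i) b) →
  E G a b

-- The graphs F_k and Γ_k.  K = {v_1,…,v_{2k-1}} is indexed by Fin (2k-1),
-- with v_i represented by index i-1 (so v_1 ↦ 0, v_2 ↦ 1).

data FV (n : ℕ) : Set where
  kv : Fin n → FV n
  uv : (i j : Fin n) → T (toℕ i <ᵇ toℕ j) → FV n

FAdj : {n : ℕ} → FV n → FV n → Set
FAdj (kv a)     (kv b)     = a ≢ b
FAdj (kv a)     (uv i j _) = a ≢ i × a ≢ j
FAdj (uv i j _) (kv a)     = a ≢ i × a ≢ j
FAdj (uv _ _ _) (uv _ _ _) = ⊥′
  where open import Data.Empty using () renaming (⊥ to ⊥′)

notU12 : {n : ℕ} → FV n → Bool
notU12 (kv _)     = true
notU12 (uv i j _) = not ((toℕ i ≡ᵇ 0) ∧ (toℕ j ≡ᵇ 1))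

nK : ℕ → ℕ
nK k = k + k ∸ 1

F : ℕ → Graph
F k = record { V = FV (nK k) ; E = FAdj }

Γ : ℕ → Graph
Γ k = record
  { V = Σ (FV (nK k)) (λ v → T (notU12 v))
  ; E = λ x y → FAdj (proj₁ x) (proj₁ y) }

vK : (k : ℕ) → Fin (nK k) → V (Γ k)
vK k c = kv c , tt

private
  2≤nK : ∀ {k} → 2 ≤ k → 2 ≤ nK k
  2≤nK {suc (suc m)} (s≤s (s≤s _)) = s≤s (≤-trans (s≤s z≤n) (m≤n+m (suc (suc m)) m))

i₁ i₂ : {k : ℕ} → 2 ≤ k → Fin (nK k)
i₁ h = fromℕ< (≤-trans (s≤s z≤n) (2≤nK h))
i₂ h = fromℕ< (2≤nK h)

v₁ v₂ : {k : ℕ} → 2 ≤ k → V (Γ k)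
v₁ {k} h = vK k (i₁ h)
v₂ {k} h = vK k (i₂ h)

module Submission where

-- Part 1. Let x and y be the first and the last vertex of K in a k-C-E ordering.
-- Unless {x, y} = {v₁, v₂}, the vertex u = u_{x,y} of Γ_k exists, and it is
-- adjacent to all of K except x and y.  Of the 2k − 3 remaining vertices of K,
-- at least k − 1 lie on one side of u; together with x (before u) or y (after u)
-- they form a (k − 1)-clique between two non-adjacent vertices, which the
-- k-C-E property forbids.
--
-- Part 2. Order K as v₁, v₃, v₄, …, v_{2k−1}, v₂ and put every independent
-- vertex into the middle of K: u_{i,j} comes right after the (k − 1)-th vertex
-- of K, or right after the k-th one when i = 2.  Two non-adjacent vertices then
-- have at most k − 2 vertices of K strictly between them that are adjacent to
-- both (for k = 2 the only candidate, v₃, is missed by every independent vertex),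
-- and v₁, v₂ are the first and last vertices of the whole ordering.

open import Defs
open import Data.Bool using (Bool; true; false; T; not; _∧_)
open import Data.Bool.Properties using (T-irrelevant)
open import Data.Empty using (⊥; ⊥-elim)
open import Data.Fin using (Fin; toℕ; fromℕ<; inject≤) renaming (zero to fzero; suc to fsuc)
open import Data.Fin.Properties
  using (toℕ-injective; toℕ-fromℕ<; toℕ<n; inject≤-injective; injective⇒≤)
  renaming (_≟_ to _≟ᶠ_)
open import Data.List using (List; []; _∷_; [_]; _++_; length; lookup; filter; map; concatMap; allFin; deduplicate)
open import Data.List.Properties using (filter-all; length-tabulate)
open import Data.List.Extrema.Nat using (argmin; argmax; f[argmin]≤f[xs]; f[xs]≤f[argmax])
open import Data.List.Membership.Propositional using (_∈_; lose)
open import Data.List.Membership.Propositional.Properties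
  using (∈-lookup; ∈-deduplicate⁺; ∈-allFin; ∈-map⁺; ∈-++⁺ˡ; ∈-++⁺ʳ; ∈-concatMap⁺
        ; ∈-filter⁻)
open import Data.List.Relation.Binary.Permutation.Propositional using (↭⇒↭ₛ; ↭-sym)
open import Data.List.Relation.Binary.Permutation.Propositional.Properties using (∈-resp-↭)
import Data.List.Relation.Binary.Permutation.Setoid.Properties as Permutationₛ
open import Data.List.Relation.Unary.All as All using (All)
open import Data.List.Relation.Unary.AllPairs using ([]; _∷_)
open import Data.List.Relation.Unary.Any using (index; here)
open import Data.List.Relation.Unary.Any.Properties using (lookup-index)
open import Data.List.Relation.Unary.Sorted.TotalOrder.Properties using (lookup-mono-≤)
open import Data.List.Relation.Unary.Unique.Propositional using (Unique)
import Data.List.Relation.Unary.Unique.Propositional.Properties as Uniqueₚ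
import Data.List.Relation.Unary.Unique.DecPropositional.Properties as UniqueDec
import Data.List.Sort as Sort
open import Data.Nat
  using (ℕ; zero; suc; _+_; _*_; _∸_; _⊓_; _≤_; _<_; z≤n; s≤s; s≤s⁻¹; _≤?_; _<?_; _<ᵇ_; _≡ᵇ_)
open import Data.Nat.Properties
  using ( _≟_; ≤-refl; ≤-reflexive; ≤-trans; ≤-antisym; <-asym; <⇒≤; <⇒≱; ≰⇒>; ≮⇒≥
        ; ≤∧≢⇒<
        ; ≤-<-trans; <-≤-trans; <-cmp; n≤1+n; m≤n⇒m≤1+n; 1+n≰n; 0≢1+n; suc-injective
        ; +-suc; m≤m+n; m≤n+m; m<m+n; +-monoˡ-≤; +-monoʳ-≤; +-cancelˡ-≤
        ; *-suc; *-monoʳ-≤; *-monoʳ-<; *-cancelˡ-≤; *-cancelˡ-<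
        ; ∸-monoˡ-<; ∸-cancelʳ-≡; m+n∸m≡n; m≤n⇒m⊓n≡m; m≥n⇒m⊓n≡n
        ; <ᵇ⇒<; <⇒<ᵇ; ≤-decTotalOrder; module ≤-Reasoning )
open import Data.Product using (Σ; _×_; _,_; proj₁; proj₂)
open import Data.Product.Properties using (≡-dec)
open import Data.Sum using (_⊎_; inj₁; inj₂; [_,_]′; swap)
import Data.Sum as Sum
open import Data.Unit using (tt)
open import Function using (_∘_; id)
open import Function.Bundles using (_⤖_; Bijection; mk⤖)
open import Function.Definitions using (Injective)
open import Relation.Binary.Bundles using (DecTotalOrder)
import Relation.Binary.Construct.On as On
open import Relation.Binary.Definitions using (DecidableEquality; tri<; tri≈; tri>)
open import Relation.Binary.PropositionalEquality
  using (_≡_; _≢_; refl; sym; trans; cong; subst; subst₂; setoid)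
open import Relation.Nullary using (¬_; Dec; yes; no; ¬?; contradiction)
open import Relation.Nullary.Decidable using (_×-dec_)
open import Relation.Unary using (Pred; Decidable)
open import Relation.Unary.Properties using (∁?)

module _ {A : Set} where

  lookup-injective : {xs : List A} → Unique xs → Injective _≡_ _≡_ (lookup xs)
  lookup-injective {_ ∷ _} (_ ∷ _) {fzero} {fzero} _ = refl
  lookup-injective {_ ∷ _} (x∉ ∷ _) {fzero} {fsuc j} eq =
    contradiction eq (All.lookup x∉ (∈-lookup j))
  lookup-injective {_ ∷ _} (x∉ ∷ _) {fsuc i} {fzero} eq =
    contradiction (sym eq) (All.lookup x∉ (∈-lookup i))
  lookup-injective {_ ∷ _} (_ ∷ unique) {fsuc i} {fsuc j} eq = cong fsuc (lookup-injective unique eq)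

  indexBijection : (xs : List A) → Unique xs → (∀ x → x ∈ xs) → A ⤖ Fin (length xs)
  indexBijection xs unique complete = mk⤖ (injective , surjective)
    where
    injective : Injective _≡_ _≡_ (λ x → index (complete x))
    injective {x} {y} eq =
      trans (lookup-index (complete x)) (trans (cong (lookup xs) eq) (sym (lookup-index (complete y))))
    surjective : ∀ i → Σ A λ x → ∀ {z} → z ≡ x → index (complete z) ≡ i
    surjective i = lookup xs i , λ { refl →
      lookup-injective unique (sym (lookup-index (complete (lookup xs i)))) }

  select : {xs : List A} → Unique xs → ∀ {r} → r ≤ length xs →
    Σ (Fin r → A) λ S → Injective _≡_ _≡_ S × ∀ l → S l ∈ xs
  select {xs} unique r≤ = (λ l → lookup xs (inject≤ l r≤))
    , (λ eq → inject≤-injective r≤ r≤ _ _ (lookup-injective unique eq))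
    , λ l → ∈-lookup (inject≤ l r≤)

  length-filter+filter-∁ : ∀ {ℓ} {P : Pred A ℓ} (P? : Decidable P) (xs : List A) →
    length (filter P? xs) + length (filter (∁? P?) xs) ≡ length xs
  length-filter+filter-∁ P? [] = refl
  length-filter+filter-∁ P? (x ∷ xs) with P? x
  ... | yes _ = cong suc (length-filter+filter-∁ P? xs)
  ... | no _ = trans (+-suc _ _) (cong suc (length-filter+filter-∁ P? xs))

  length-filter-≢ : (_≟ᴬ_ : DecidableEquality A) (z : A) {xs : List A} → Unique xs →
    length xs ≤ suc (length (filter (λ x → ¬? (x ≟ᴬ z)) xs))
  length-filter-≢ _≟ᴬ_ z {[]} [] = z≤n
  length-filter-≢ _≟ᴬ_ z {x ∷ xs} (x∉xs ∷ unique) with x ≟ᴬ z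
  ... | yes refl = s≤s (≤-reflexive (sym (cong length
          (filter-all (λ y → ¬? (y ≟ᴬ z)) (All.map (_∘ sym) x∉xs)))))
  ... | no _ = s≤s (length-filter-≢ _≟ᴬ_ z unique)

module _ {A : Set} (key : A → ℕ) where
  private
    byKey : DecTotalOrder _ _ _
    byKey = On.decTotalOrder ≤-decTotalOrder key
    open Sort byKey using (sort; sort-↭; sort-↗)

  sortedIndexBijection : (xs : List A) → Unique xs → (∀ x → x ∈ xs) →
    Σ (A ⤖ Fin (length (sort xs))) λ φ →
      ∀ x y → key x < key y → toℕ (Bijection.to φ x) < toℕ (Bijection.to φ y)
  sortedIndexBijection xs unique complete = φ , monotone
    where
    sorted-complete : ∀ x → x ∈ sort xs
    sorted-complete x = ∈-resp-↭ (↭-sym (sort-↭ xs)) (complete x)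
    sorted-unique : Unique (sort xs)
    sorted-unique = Permutationₛ.Unique-resp-↭ (setoid A) (↭⇒↭ₛ (↭-sym (sort-↭ xs))) unique
    φ : A ⤖ Fin (length (sort xs))
    φ = indexBijection (sort xs) sorted-unique sorted-complete
    monotone : ∀ x y → key x < key y → toℕ (Bijection.to φ x) < toℕ (Bijection.to φ y)
    monotone x y kx<ky = ≰⇒> λ iy≤ix → <⇒≱ kx<ky
      (subst₂ (λ a b → key a ≤ key b)
        (sym (lookup-index (sorted-complete y))) (sym (lookup-index (sorted-complete x)))
        (lookup-mono-≤ (DecTotalOrder.totalOrder byKey) (sort-↗ xs) iy≤ix))

orderingByKey : (G : Graph) → DecidableEquality (V G) → (xs : List (V G)) → (∀ x → x ∈ xs) →
  (key : V G → ℕ) → Σ (Ordering G) λ φ → ∀ x y → key x < key y → _<[_]_ {G} x φ y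
orderingByKey G _≟ⱽ_ xs complete key
  with φ , monotone ← sortedIndexBijection key (deduplicate _≟ⱽ_ xs) (UniqueDec.deduplicate-! _≟ⱽ_ xs)
                        (λ x → ∈-deduplicate⁺ _≟ⱽ_ (complete x))
  = (_ , φ) , monotone

Within : ℕ → ℕ → ℕ → Set
Within x y z = (x ≤ y × y ≤ z) ⊎ (z ≤ y × y ≤ x)

module KeyOrdering {G : Graph} (φ : Ordering G) (key : V G → ℕ)
                   (monotone : ∀ x y → key x < key y → _<[_]_ {G} x φ y) where

  precedes⇒key≤ : ∀ {x y} → _<[_]_ {G} x φ y → key x ≤ key y
  precedes⇒key≤ x<y = ≮⇒≥ λ ky<kx → <-asym x<y (monotone _ _ ky<kx)

  between⇒within : ∀ {a w b} → Between {G} φ a w b → Within (key a) (key w) (key b)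
  between⇒within (inj₁ (a<w , w<b)) = inj₁ (precedes⇒key≤ a<w , precedes⇒key≤ w<b)
  between⇒within (inj₂ (b<w , w<a)) = inj₂ (precedes⇒key≤ b<w , precedes⇒key≤ w<a)

module PositionFacts {G : Graph} (ψ : Ordering G) where

  position : V G → ℕ
  position x = toℕ (Bijection.to (proj₂ ψ) x)

  position-injective : ∀ {x y} → position x ≡ position y → x ≡ y
  position-injective eq = Bijection.injective (proj₂ ψ) (toℕ-injective eq)

  ≮⇒> : ∀ {x y} → x ≢ y → ¬ _<[_]_ {G} x ψ y → _<[_]_ {G} y ψ x
  ≮⇒> x≢y x≮y = ≤∧≢⇒< (≮⇒≥ x≮y) (λ eq → x≢y (position-injective (sym eq)))

  FirstOf LastOf : {n : ℕ} → (Fin n → V G) → Fin n → Set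
  FirstOf K x = ∀ c → c ≢ x → _<[_]_ {G} (K x) ψ (K c)
  LastOf K y = ∀ c → c ≢ y → _<[_]_ {G} (K c) ψ (K y)

  first≢last : ∀ {n} (K : Fin n → V G) {x y c d} → FirstOf K x → LastOf K y → c ≢ d → x ≢ y
  first≢last K {x} {c = c} {d} x-first y-last c≢d refl with c ≟ᶠ x
  ... | yes refl = <-asym (x-first d (c≢d ∘ sym)) (y-last d (c≢d ∘ sym))
  ... | no c≢x = <-asym (x-first c c≢x) (y-last c c≢x)

  module _ {n : ℕ} (K : Fin (suc n) → V G) (K-injective : Injective _≡_ _≡_ K) where
    private
      ≤∧≢⇒precedes : ∀ {c d} → position (K c) ≤ position (K d) → c ≢ d → _<[_]_ {G} (K c) ψ (K d)
      ≤∧≢⇒precedes le c≢d = ≤∧≢⇒< le (λ eq → c≢d (K-injective (position-injective eq)))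

    earliest : Σ (Fin (suc n)) (FirstOf K)
    earliest = x , λ c c≢x → ≤∧≢⇒precedes (All.lookup x-minimal (∈-allFin c)) (c≢x ∘ sym)
      where
      x : Fin (suc n)
      x = argmin (position ∘ K) fzero (allFin _)
      x-minimal : All (λ c → position (K x) ≤ position (K c)) (allFin _)
      x-minimal = f[argmin]≤f[xs] fzero (allFin _)

    latest : Σ (Fin (suc n)) (LastOf K)
    latest = y , λ c c≢y → ≤∧≢⇒precedes (All.lookup y-maximal (∈-allFin c)) c≢y
      where
      y : Fin (suc n)
      y = argmax (position ∘ K) fzero (allFin _)
      y-maximal : All (λ c → position (K c) ≤ position (K y)) (allFin _)
      y-maximal = f[xs]≤f[argmax] fzero (allFin _)

module CliqueEnds {G : Graph} {m n : ℕ} (ψ : Ordering G) (kce : IsKCE G (2 + m) ψ)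
  (K : Fin n → V G) (K-injective : Injective _≡_ _≡_ K)
  (K-clique : ∀ c d → c ≢ d → E G (K c) (K d)) where

  open PositionFacts {G} ψ using (position; ≮⇒>; FirstOf; LastOf)

  adjacent-if-clique-between : (a b : V G) → a ≢ b →
    (zs : List (Fin n)) → Unique zs → suc m ≤ length zs →
    (∀ {c} → c ∈ zs → (a ≢ K c × E G a (K c)) × (b ≢ K c × E G b (K c))
                      × Between {G} ψ a (K c) b) →
    E G a b
  adjacent-if-clique-between a b a≢b zs unique large between
    with S , S-injective , S∈zs ← select unique large
    = kce (K ∘ S) a b (S-injective ∘ K-injective) (λ i j i≢j → K-clique _ _ (i≢j ∘ S-injective))
          (proj₁ ∘ between ∘ S∈zs) (proj₁ ∘ proj₂ ∘ between ∘ S∈zs) a≢b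
          (proj₂ ∘ proj₂ ∘ between ∘ S∈zs)

  first-or-last-adjacent : 3 + (m + m) ≤ n → (x y : Fin n) → FirstOf K x → LastOf K y →
    (u : V G) → (∀ c → u ≢ K c) → (∀ c → c ≢ x → c ≢ y → E G u (K c)) →
    E G (K x) u ⊎ E G u (K y)
  first-or-last-adjacent large x y x-first y-last u u∉K u-adjacent = by-side (suc m ≤? length before)
    where
    ≢x? : Decidable (λ c → c ≢ x)
    ≢x? c = ¬? (c ≟ᶠ x)
    ≢y? : Decidable (λ c → c ≢ y)
    ≢y? c = ¬? (c ≟ᶠ y)
    others : List (Fin n)
    others = filter ≢y? (filter ≢x? (allFin n))
    others-unique : Unique others
    others-unique = Uniqueₚ.filter⁺ ≢y? {filter ≢x? (allFin n)} (Uniqueₚ.filter⁺ ≢x? (Uniqueₚ.allFin⁺ n))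
    other : ∀ {c} → c ∈ others → c ≢ x × c ≢ y
    other c∈ = let c∈' , c≢y = ∈-filter⁻ ≢y? {xs = filter ≢x? (allFin n)} c∈
               in proj₂ (∈-filter⁻ ≢x? {xs = allFin n} c∈') , c≢y
    others-large : suc (m + m) ≤ length others
    others-large = s≤s⁻¹ (s≤s⁻¹ (begin
      3 + (m + m)                           ≤⟨ large ⟩
      n                                     ≡⟨ length-tabulate id ⟨
      length (allFin n)                     ≤⟨ length-filter-≢ _≟ᶠ_ x (Uniqueₚ.allFin⁺ n) ⟩
      suc (length (filter ≢x? (allFin n)))  ≤⟨ s≤s (length-filter-≢ _≟ᶠ_ y
                                                    (Uniqueₚ.filter⁺ ≢x? (Uniqueₚ.allFin⁺ n))) ⟩
      suc (suc (length others))             ∎))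
      where open ≤-Reasoning
    before? : Decidable (λ c → position (K c) < position u)
    before? c = position (K c) <? position u
    before after : List (Fin n)
    before = filter before? others
    after = filter (∁? before?) others
    by-side : Dec (suc m ≤ length before) → E G (K x) u ⊎ E G u (K y)
    by-side (yes m<before) = inj₁ (adjacent-if-clique-between (K x) u (u∉K x ∘ sym) before
      (Uniqueₚ.filter⁺ before? others-unique) m<before λ c∈ →
        let c∈others , c<u = ∈-filter⁻ before? c∈ ; c≢x , c≢y = other c∈others in
          ((λ eq → c≢x (K-injective (sym eq))) , K-clique x _ (c≢x ∘ sym))
        , (u∉K _ , u-adjacent _ c≢x c≢y)
        , inj₁ (x-first _ c≢x , c<u))
    by-side (no m≮before) = inj₂ (adjacent-if-clique-between u (K y) (u∉K y) after
      (Uniqueₚ.filter⁺ (∁? before?) others-unique) m<after λ c∈ →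
        let c∈others , c≮u = ∈-filter⁻ (∁? before?) c∈ ; c≢x , c≢y = other c∈others in
          (u∉K _ , u-adjacent _ c≢x c≢y)
        , ((λ eq → c≢y (K-injective (sym eq))) , K-clique y _ (c≢y ∘ sym))
        , inj₁ (≮⇒> (u∉K _ ∘ sym) c≮u , y-last _ c≢y))
      where
      m<after : suc m ≤ length after
      m<after = +-cancelˡ-≤ m _ _ (begin
        m + suc m                     ≡⟨ +-suc m m ⟩
        suc (m + m)                   ≤⟨ others-large ⟩
        length others                 ≡⟨ length-filter+filter-∁ before? others ⟨
        length before + length after  ≤⟨ +-monoˡ-≤ (length after) (≮⇒≥ m≮before) ⟩
        m + length after              ∎)
        where open ≤-Reasoning

no-injection-into-window : ∀ {r lo} (f : Fin (suc r) → ℕ) → Injective _≡_ _≡_ f →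
  (∀ l → lo ≤ f l × f l < lo + r) → ⊥
no-injection-into-window {r} {lo} f f-injective window = 1+n≰n (injective⇒≤ offset-injective)
  where
  offset : Fin (suc r) → Fin r
  offset l = fromℕ< (subst (f l ∸ lo <_) (m+n∸m≡n lo r)
                            (∸-monoˡ-< (proj₂ (window l)) (proj₁ (window l))))
  offset-injective : Injective _≡_ _≡_ offset
  offset-injective {l} {l'} eq = f-injective (∸-cancelʳ-≡ (proj₁ (window l)) (proj₁ (window l'))
    (trans (sym (toℕ-fromℕ< _)) (trans (cong toℕ eq) (toℕ-fromℕ< _))))

even≤odd⇒≤ : ∀ {a b} → 2 * a ≤ suc (2 * b) → a ≤ b
even≤odd⇒≤ {a} {b} le =
  s≤s⁻¹ (*-cancelˡ-< 2 a (suc b) (≤-trans (s≤s le) (≤-reflexive (sym (*-suc 2 b)))))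

odd≤even⇒< : ∀ {a b} → suc (2 * b) ≤ 2 * a → b < a
odd≤even⇒< {a} {b} = *-cancelˡ-< 2 b a

witnesses : (b : Bool) → List (T b)
witnesses true = [ tt ]
witnesses false = []

∈-witnesses : ∀ {b} (t : T b) → t ∈ witnesses b
∈-witnesses {true} tt = here refl

module _ {n : ℕ} where

  _≟ᶠᵛ_ : DecidableEquality (FV n)
  kv c ≟ᶠᵛ kv d with c ≟ᶠ d
  ... | yes refl = yes refl
  ... | no c≢d = no λ { refl → c≢d refl }
  kv _ ≟ᶠᵛ uv _ _ _ = no λ ()
  uv _ _ _ ≟ᶠᵛ kv _ = no λ ()
  uv i j p ≟ᶠᵛ uv i' j' p' with i ≟ᶠ i' | j ≟ᶠ j'
  ... | yes refl | yes refl = yes (cong (uv i j) (T-irrelevant p p'))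
  ... | no i≢i' | _ = no λ { refl → i≢i' refl }
  ... | _ | no j≢j' = no λ { refl → j≢j' refl }

  fVertices : List (FV n)
  fVertices = map kv (allFin n) ++
    concatMap (λ i → concatMap (λ j → map (uv i j) (witnesses (toℕ i <ᵇ toℕ j))) (allFin n)) (allFin n)

  ∈-fVertices : ∀ v → v ∈ fVertices
  ∈-fVertices (kv c) = ∈-++⁺ˡ (∈-map⁺ kv (∈-allFin c))
  ∈-fVertices (uv i j p) = ∈-++⁺ʳ (map kv (allFin n)) (∈-concatMap⁺ _ (lose (∈-allFin i)
    (∈-concatMap⁺ _ (lose (∈-allFin j) (∈-map⁺ (uv i j) (∈-witnesses p))))))

Γ-decEq : (k : ℕ) → DecidableEquality (V (Γ k))
Γ-decEq k = ≡-dec _≟ᶠᵛ_ λ p q → yes (T-irrelevant p q)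

Γ-vertices : (k : ℕ) → List (V (Γ k))
Γ-vertices k = concatMap (λ v → map (v ,_) (witnesses (notU12 v))) (fVertices {nK k})

∈-Γ-vertices : (k : ℕ) (x : V (Γ k)) → x ∈ Γ-vertices k
∈-Γ-vertices k (v , q) = ∈-concatMap⁺ _ (lose (∈-fVertices v) (∈-map⁺ (v ,_) (∈-witnesses q)))

vK-injective : ∀ {k} → Injective _≡_ _≡_ (vK k)
vK-injective refl = refl

notU12-intro : ∀ {a b} → ¬ (a ≡ 0 × b ≡ 1) → T (not ((a ≡ᵇ 0) ∧ (b ≡ᵇ 1)))
notU12-intro {zero} {zero} _ = tt
notU12-intro {zero} {suc zero} not01 = contradiction (refl , refl) not01
notU12-intro {zero} {suc (suc _)} _ = tt
notU12-intro {suc _} _ = tt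

second-index≥2 : ∀ {a b} → a < b → T (not ((a ≡ᵇ 0) ∧ (b ≡ᵇ 1))) → 2 ≤ b
second-index≥2 {zero} {suc (suc _)} _ _ = s≤s (s≤s z≤n)
second-index≥2 {suc _} {suc (suc _)} _ _ = s≤s (s≤s z≤n)
second-index≥2 {suc _} {suc zero} (s≤s ()) _

vertex-missing-pair : ∀ {k} (x y : Fin (nK k)) → x ≢ y →
  ¬ (toℕ x ≡ 0 × toℕ y ≡ 1) → ¬ (toℕ x ≡ 1 × toℕ y ≡ 0) →
  Σ (V (Γ k)) λ u → (∀ c → u ≢ vK k c) × (∀ c → c ≢ x → c ≢ y → E (Γ k) u (vK k c))
                  × ¬ E (Γ k) (vK k x) u × ¬ E (Γ k) u (vK k y)
vertex-missing-pair x y x≢y not01 not10 with <-cmp (toℕ x) (toℕ y)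
... | tri< x<y _ _ = (uv x y (<⇒<ᵇ x<y) , notU12-intro not01)
  , (λ _ ()) , (λ _ c≢x c≢y → c≢x , c≢y) , (λ adj → proj₁ adj refl) , (λ adj → proj₂ adj refl)
... | tri≈ _ x≡y _ = contradiction (toℕ-injective x≡y) x≢y
... | tri> _ _ y<x = (uv y x (<⇒<ᵇ y<x) , notU12-intro (λ (y≡0 , x≡1) → not10 (x≡1 , y≡0)))
  , (λ _ ()) , (λ _ c≢x c≢y → c≢y , c≢x) , (λ adj → proj₂ adj refl) , (λ adj → proj₁ adj refl)

module _ (m : ℕ) where
  private
    k = 2 + m
    n = nK k
    h : 2 ≤ k
    h = s≤s (s≤s z≤n)

  nK≡3+2m : nK (2 + m) ≡ 3 + (m + m)
  nK≡3+2m = cong suc (trans (+-suc m (suc m)) (cong suc (+-suc m m)))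

  toℕ-bound : (c : Fin n) → toℕ c ≤ 2 + (m + m)
  toℕ-bound c = s≤s⁻¹ (≤-trans (toℕ<n c) (≤-reflexive nK≡3+2m))

  toℕ-i₂ : toℕ (i₂ h) ≡ 1
  toℕ-i₂ = toℕ-fromℕ< (≤-trans (s≤s (s≤s z≤n)) (≤-reflexive (sym nK≡3+2m)))

  module _ (ψ : Ordering (Γ k)) (kce : IsKCE (Γ k) k ψ) where
    open PositionFacts {Γ k} ψ using (FirstOf; LastOf; earliest; latest; first≢last)
    open CliqueEnds {Γ k} ψ kce (vK k) (vK-injective {k}) (λ _ _ c≢d → c≢d) using (first-or-last-adjacent)

    EndsOfK : Fin n → Fin n → Set
    EndsOfK x y = FirstOf (vK k) x × LastOf (vK k) y

    v₁-v₂-are-ends-of-K : EndsOfK (i₁ h) (i₂ h) ⊎ EndsOfK (i₂ h) (i₁ h)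
    v₁-v₂-are-ends-of-K = ends (earliest (vK k) (vK-injective {k})) (latest (vK k) (vK-injective {k}))
      where
      ends : Σ _ (FirstOf (vK k)) → Σ _ (LastOf (vK k)) → EndsOfK (i₁ h) (i₂ h) ⊎ EndsOfK (i₂ h) (i₁ h)
      ends (x , x-first) (y , y-last)
        with x ≟ᶠ i₁ h ×-dec y ≟ᶠ i₂ h | x ≟ᶠ i₂ h ×-dec y ≟ᶠ i₁ h
      ... | yes (refl , refl) | _ = inj₁ (x-first , y-last)
      ... | no _ | yes (refl , refl) = inj₂ (x-first , y-last)
      ... | no not12 | no not21 =
        let u , u∉K , u-adjacent , x≁u , u≁y = vertex-missing-pair {k} x y
              (first≢last (vK k) x-first y-last λ i₁≡i₂ → 0≢1+n (trans (cong toℕ i₁≡i₂) toℕ-i₂))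
              (λ (x≡0 , y≡1) → not12 (toℕ-injective x≡0 , toℕ-injective (trans y≡1 (sym toℕ-i₂))))
              (λ (x≡1 , y≡0) → not21 (toℕ-injective (trans x≡1 (sym toℕ-i₂)) , toℕ-injective y≡0))
        in ⊥-elim ([ x≁u , u≁y ]′ (first-or-last-adjacent (≤-reflexive (sym nK≡3+2m))
                                     x y x-first y-last u u∉K u-adjacent))

  -- Index r stands for v_{r+1}; ranks list K as v₁, v₃, v₄, …, v_{2k−1}, v₂.
  rank : ℕ → ℕ
  rank zero = zero
  rank (suc zero) = 2 + (m + m)
  rank (suc (suc r)) = suc r

  rank-injective : ∀ {a b} → a ≤ 2 + (m + m) → b ≤ 2 + (m + m) → rank a ≡ rank b → a ≡ b
  rank-injective {zero} {zero} _ _ _ = refl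
  rank-injective {suc zero} {suc zero} _ _ _ = refl
  rank-injective {suc (suc a)} {suc (suc b)} _ _ eq = cong (2 +_) (suc-injective eq)
  rank-injective {zero} {suc zero} _ _ ()
  rank-injective {zero} {suc (suc _)} _ _ ()
  rank-injective {suc zero} {zero} _ _ ()
  rank-injective {suc (suc _)} {zero} _ _ ()
  rank-injective {suc zero} {suc (suc b)} _ b≤ eq =
    contradiction (s≤s⁻¹ (s≤s⁻¹ b≤)) (<⇒≱ (≤-reflexive (suc-injective eq)))
  rank-injective {suc (suc a)} {suc zero} a≤ _ eq =
    contradiction (s≤s⁻¹ (s≤s⁻¹ a≤)) (<⇒≱ (≤-reflexive (sym (suc-injective eq))))

  rank-positive : ∀ {r} → r ≢ 0 → 1 ≤ rank r
  rank-positive {zero} r≢0 = contradiction refl r≢0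
  rank-positive {suc zero} _ = s≤s z≤n
  rank-positive {suc (suc r)} _ = s≤s z≤n

  rank-below-last : ∀ {r} → r ≤ 2 + (m + m) → r ≢ 1 → rank r ≤ suc (m + m)
  rank-below-last {zero} _ _ = z≤n
  rank-below-last {suc zero} _ r≢1 = contradiction refl r≢1
  rank-below-last {suc (suc r)} r≤ _ = s≤s⁻¹ r≤

  rank-bound : ∀ {r} → r ≤ 2 + (m + m) → rank r ≤ 2 + (m + m)
  rank-bound {suc zero} _ = ≤-refl
  rank-bound {zero} _ = z≤n
  rank-bound {suc (suc r)} r≤ = m≤n⇒m≤1+n (s≤s⁻¹ r≤)

  rank≡1+m⇒≡2+m : ∀ {r} → rank r ≡ suc m → r ≡ 2 + m
  rank≡1+m⇒≡2+m {suc zero} eq =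
    contradiction (≤-trans (≤-reflexive (suc-injective eq)) (m≤m+n m m)) 1+n≰n
  rank≡1+m⇒≡2+m {suc (suc r)} eq = cong (2 +_) (suc-injective eq)

  slot : ℕ → ℕ
  slot zero = m
  slot (suc zero) = suc m
  slot (suc (suc _)) = m

  slot-bounds : ∀ r → m ≤ slot r × slot r ≤ suc m
  slot-bounds zero = ≤-refl , n≤1+n m
  slot-bounds (suc zero) = n≤1+n m , ≤-refl
  slot-bounds (suc (suc _)) = ≤-refl , n≤1+n m

  slot-other : ∀ {r} → r ≢ 1 → slot r ≡ m
  slot-other {zero} _ = refl
  slot-other {suc zero} r≢1 = contradiction refl r≢1
  slot-other {suc (suc _)} _ = refl

  slot-near-rank : ∀ {a b c} → a < b → 2 ≤ b → b ≤ 2 + (m + m) → c ≡ a ⊎ c ≡ b →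
    slot a ≤ rank c + m × rank c ≤ suc (slot a + m)
  slot-near-rank {a} {b} a<b 2≤b b≤ c∈ab with a ≟ 1 | c∈ab
  ... | yes refl | inj₁ refl = +-monoˡ-≤ m (rank-positive {1} λ ()) , ≤-refl
  ... | yes refl | inj₂ refl =
    +-monoˡ-≤ m (rank-positive {b} λ { refl → contradiction 2≤b λ () }) , rank-bound b≤
  ... | no a≢1 | inj₁ refl rewrite slot-other a≢1 =
    m≤n+m m _ , rank-below-last {a} (≤-trans (<⇒≤ a<b) b≤) a≢1
  ... | no a≢1 | inj₂ refl rewrite slot-other a≢1 =
    m≤n+m m _ , rank-below-last {b} b≤ λ { refl → contradiction 2≤b λ { (s≤s ()) } }

  within-even-odd⇒window : ∀ {a s w} → s ≤ a + m → a ≤ suc (s + m) → a ≢ w →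
    Within (2 * a) (2 * w) (suc (2 * s)) → suc (a ⊓ s) ≤ w × w < suc (a ⊓ s) + m
  within-even-odd⇒window {a} {s} {w} s≤a+m a≤s+m+1 a≢w within with a ≤? s | within
  ... | yes a≤s | inj₁ (2a≤2w , 2w≤2s+1) rewrite m≤n⇒m⊓n≡m a≤s =
    ≤∧≢⇒< (*-cancelˡ-≤ {a} {w} 2 2a≤2w) a≢w , s≤s (≤-trans (even≤odd⇒≤ 2w≤2s+1) s≤a+m)
  ... | yes a≤s | inj₂ (2s+1≤2w , 2w≤2a) =
    contradiction (≤-trans (*-cancelˡ-≤ {w} {a} 2 2w≤2a) a≤s) (<⇒≱ (odd≤even⇒< 2s+1≤2w))
  ... | no a≰s | inj₁ (2a≤2w , 2w≤2s+1) =
    contradiction (≤-trans (*-cancelˡ-≤ {a} {w} 2 2a≤2w) (even≤odd⇒≤ 2w≤2s+1)) a≰s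
  ... | no a≰s | inj₂ (2s+1≤2w , 2w≤2a) rewrite m≥n⇒m⊓n≡n (<⇒≤ (≰⇒> a≰s)) =
    odd≤even⇒< 2s+1≤2w , <-≤-trans (≤∧≢⇒< (*-cancelˡ-≤ {w} {a} 2 2w≤2a) (a≢w ∘ sym)) a≤s+m+1

  within-odd-odd⇒middle : ∀ a b {w} → Within (suc (2 * slot a)) (2 * w) (suc (2 * slot b)) → w ≡ suc m
  within-odd-odd⇒middle a b (inj₁ (2s+1≤2w , 2w≤2s'+1)) =
    ≤-antisym (≤-trans (even≤odd⇒≤ 2w≤2s'+1) (proj₂ (slot-bounds b)))
              (≤-<-trans (proj₁ (slot-bounds a)) (odd≤even⇒< 2s+1≤2w))
  within-odd-odd⇒middle a b (inj₂ (2s'+1≤2w , 2w≤2s+1)) =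
    ≤-antisym (≤-trans (even≤odd⇒≤ 2w≤2s+1) (proj₂ (slot-bounds a)))
              (≤-<-trans (proj₁ (slot-bounds b)) (odd≤even⇒< 2s'+1≤2w))

  -- u_{i,j} comes right after the vertex of K of rank slot i; doubling makes the
  -- keys of K even and those of the independent vertices odd, so no ties arise between them.
  key : V (Γ k) → ℕ
  key (kv c , _) = 2 * rank (toℕ c)
  key (uv i _ _ , _) = suc (2 * slot (toℕ i))

  Φ : Ordering (Γ k)
  Φ = proj₁ (orderingByKey (Γ k) (Γ-decEq k) (Γ-vertices k) (∈-Γ-vertices k) key)

  Φ-monotone : ∀ x y → key x < key y → _<[_]_ {Γ k} x Φ y
  Φ-monotone = proj₂ (orderingByKey (Γ k) (Γ-decEq k) (Γ-vertices k) (∈-Γ-vertices k) key)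

  open KeyOrdering {Γ k} Φ key Φ-monotone

  K-neighbour : ∀ {i j p q} (s : V (Γ k)) → E (Γ k) (uv i j p , q) s →
    Σ (Fin n) λ w → s ≡ vK k w × w ≢ i × w ≢ j
  K-neighbour (kv w , tt) w-adjacent = w , refl , w-adjacent

  no-clique-in-window : (S : Fin (suc m) → V (Γ k)) → Injective _≡_ _≡_ S →
    (w : Fin (suc m) → Fin n) → (∀ l → S l ≡ vK k (w l)) →
    ∀ {lo} → (∀ l → lo ≤ rank (toℕ (w l)) × rank (toℕ (w l)) < lo + m) → ⊥
  no-clique-in-window S S-injective w S≡w = no-injection-into-window (rank ∘ toℕ ∘ w) injective
    where
    injective : Injective _≡_ _≡_ (rank ∘ toℕ ∘ w)
    injective {l} {l'} eq = S-injective (trans (S≡w l) (trans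
      (cong (vK k) (toℕ-injective (rank-injective (toℕ-bound (w l)) (toℕ-bound (w l')) eq))) (sym (S≡w l'))))

  no-clique-between-K-u : ∀ {c i j p q} → c ≡ i ⊎ c ≡ j →
    (S : Fin (suc m) → V (Γ k)) → Injective _≡_ _≡_ S → (∀ l → vK k c ≢ S l) →
    (∀ l → E (Γ k) (uv i j p , q) (S l)) → (∀ l → Between {Γ k} Φ (vK k c) (S l) (uv i j p , q)) → ⊥
  no-clique-between-K-u {c} {i} {j} {p} {q} c∈ij S S-injective c∉S adjacent between =
    no-clique-in-window S S-injective w S≡w λ l →
      within-even-odd⇒window (proj₁ near) (proj₂ near) (rank-c≢ l) (within l)
    where
    w : Fin (suc m) → Fin n
    w l = proj₁ (K-neighbour {i} {j} {p} {q} (S l) (adjacent l))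
    S≡w : ∀ l → S l ≡ vK k (w l)
    S≡w l = proj₁ (proj₂ (K-neighbour {i} {j} {p} {q} (S l) (adjacent l)))
    i<j : toℕ i < toℕ j
    i<j = <ᵇ⇒< (toℕ i) (toℕ j) p
    near : slot (toℕ i) ≤ rank (toℕ c) + m × rank (toℕ c) ≤ suc (slot (toℕ i) + m)
    near = slot-near-rank i<j (second-index≥2 i<j q) (toℕ-bound j) (Sum.map (cong toℕ) (cong toℕ) c∈ij)
    rank-c≢ : ∀ l → rank (toℕ c) ≢ rank (toℕ (w l))
    rank-c≢ l eq = c∉S l (trans (cong (vK k) (toℕ-injective
      (rank-injective (toℕ-bound c) (toℕ-bound (w l)) eq))) (sym (S≡w l)))
    within : ∀ l → Within (2 * rank (toℕ c)) (2 * rank (toℕ (w l))) (suc (2 * slot (toℕ i)))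
    within l = subst (λ s → Within _ (key s) _) (S≡w l) (between⇒within (between l))

  no-clique-between-u-u : ∀ {i j p q i' j' p' q'} (S : Fin (suc m) → V (Γ k)) → Injective _≡_ _≡_ S →
    (∀ l → E (Γ k) (uv i j p , q) (S l)) →
    (∀ l → Between {Γ k} Φ (uv i j p , q) (S l) (uv i' j' p' , q')) → ⊥
  no-clique-between-u-u {i} {j} {p} {q} {i'} S S-injective adjacent between = by-size (1 ≤? m)
    where
    w : Fin (suc m) → Fin n
    w l = proj₁ (K-neighbour {i} {j} {p} {q} (S l) (adjacent l))
    S≡w : ∀ l → S l ≡ vK k (w l)
    S≡w l = proj₁ (proj₂ (K-neighbour {i} {j} {p} {q} (S l) (adjacent l)))
    w≢j : ∀ l → w l ≢ j
    w≢j l = proj₂ (proj₂ (proj₂ (K-neighbour {i} {j} {p} {q} (S l) (adjacent l))))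
    middle : ∀ l → rank (toℕ (w l)) ≡ suc m
    middle l = within-odd-odd⇒middle (toℕ i) (toℕ i')
      (subst (λ s → Within _ (key s) _) (S≡w l) (between⇒within (between l)))
    by-size : Dec (1 ≤ m) → ⊥
    by-size (yes 1≤m) = no-clique-in-window S S-injective w S≡w λ l →
      ≤-reflexive (sym (middle l)) , subst (_< suc m + m) (sym (middle l)) (m<m+n (suc m) 1≤m)
    -- k = 2: the vertex of rank 1 is v₃, and every independent vertex is u_{1,3} or u_{2,3}.
    by-size (no 1≰m) = w≢j fzero (toℕ-injective (trans (rank≡1+m⇒≡2+m (middle fzero)) (sym toℕ-j)))
      where
      m≤0 : m ≤ 0
      m≤0 = ≮⇒≥ 1≰m
      i<j = <ᵇ⇒< (toℕ i) (toℕ j) p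
      toℕ-j : toℕ j ≡ 2 + m
      toℕ-j = ≤-antisym (≤-trans (toℕ-bound j) (+-monoʳ-≤ 2 (+-monoˡ-≤ m m≤0)))
                        (≤-trans (+-monoʳ-≤ 2 m≤0) (second-index≥2 i<j q))

  K-u-adjacent : ∀ {c i j p q} (S : Fin (suc m) → V (Γ k)) → Injective _≡_ _≡_ S →
    (∀ l → vK k c ≢ S l) → (∀ l → E (Γ k) (uv i j p , q) (S l)) →
    (∀ l → Between {Γ k} Φ (vK k c) (S l) (uv i j p , q)) → E (Γ k) (vK k c) (uv i j p , q)
  K-u-adjacent S S-injective c∉S adjacent between =
    (λ c≡i → no-clique-between-K-u (inj₁ c≡i) S S-injective c∉S adjacent between) ,
    (λ c≡j → no-clique-between-K-u (inj₂ c≡j) S S-injective c∉S adjacent between)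

  Φ-kce : IsKCE (Γ k) k Φ
  Φ-kce S (kv c , tt) (kv d , tt) _ _ _ _ a≢b _ c≡d = a≢b (cong (vK k) c≡d)
  Φ-kce S (kv c , tt) (uv i j p , q) S-injective _ a-adj b-adj _ between =
    K-u-adjacent S S-injective (proj₁ ∘ a-adj) (proj₂ ∘ b-adj) between
  Φ-kce S (uv i j p , q) (kv c , tt) S-injective _ a-adj b-adj _ between =
    K-u-adjacent S S-injective (proj₁ ∘ b-adj) (proj₂ ∘ a-adj) (swap ∘ between)
  Φ-kce S (uv i j p , q) (uv _ _ _ , _) S-injective _ a-adj _ _ between =
    no-clique-between-u-u S S-injective (proj₂ ∘ a-adj) between

  v₁-least : ∀ x → x ≢ v₁ h → key (v₁ h) < key x
  v₁-least (kv c , tt) x≢v₁ =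
    *-monoʳ-< 2 (rank-positive λ c≡0 → x≢v₁ (cong (vK k) (toℕ-injective c≡0)))
  v₁-least (uv _ _ _ , _) _ = s≤s z≤n

  v₂-greatest : ∀ x → x ≢ v₂ h → key x < key (v₂ h)
  v₂-greatest x x≢v₂ = subst (λ r → key x < 2 * rank r) (sym toℕ-i₂) (below x x≢v₂)
    where
    below : ∀ x → x ≢ v₂ h → key x < 2 * (2 + (m + m))
    below (kv c , tt) x≢v₂ = *-monoʳ-< 2 (s≤s (rank-below-last (toℕ-bound c)
      λ c≡1 → x≢v₂ (cong (vK k) (toℕ-injective (trans c≡1 (sym toℕ-i₂))))))
    below (uv i _ _ , _) _ = ≤-trans (≤-reflexive (sym (*-suc 2 (slot (toℕ i)))))
      (*-monoʳ-≤ 2 (s≤s (≤-trans (proj₂ (slot-bounds (toℕ i))) (s≤s (m≤m+n m m)))))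

  kce-ordering-v₁-first-v₂-last : Σ (Ordering (Γ k)) λ φ → IsKCE (Γ k) k φ
    × ((x : V (Γ k)) → x ≢ v₁ h → _<[_]_ {Γ k} (v₁ h) φ x)
    × ((x : V (Γ k)) → x ≢ v₂ h → _<[_]_ {Γ k} x φ (v₂ h))
  kce-ordering-v₁-first-v₂-last = Φ , Φ-kce
    , (λ x x≢v₁ → Φ-monotone _ _ (v₁-least x x≢v₁))
    , (λ x x≢v₂ → Φ-monotone _ _ (v₂-greatest x x≢v₂))

mainTheorem8 : (k : ℕ) → (h : 2 ≤ k) →
    ((φ : Ordering (Γ k)) → IsKCE (Γ k) k φ →
        (((c : Fin (nK k)) → c ≢ i₁ h → _<[_]_ {Γ k} (v₁ h) φ (vK k c))
          × ((c : Fin (nK k)) → c ≢ i₂ h → _<[_]_ {Γ k} (vK k c) φ (v₂ h)))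
      ⊎ (((c : Fin (nK k)) → c ≢ i₂ h → _<[_]_ {Γ k} (v₂ h) φ (vK k c))
          × ((c : Fin (nK k)) → c ≢ i₁ h → _<[_]_ {Γ k} (vK k c) φ (v₁ h))))
    × Σ (Ordering (Γ k)) (λ φ → IsKCE (Γ k) k φ
        × ((x : V (Γ k)) → x ≢ v₁ h → _<[_]_ {Γ k} (v₁ h) φ x)
        × ((x : V (Γ k)) → x ≢ v₂ h → _<[_]_ {Γ k} x φ (v₂ h)))
mainTheorem8 (suc (suc m)) (s≤s (s≤s z≤n)) = v₁-v₂-are-ends-of-K m , kce-ordering-v₁-first-v₂-last m
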